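{- Let $G$ be a finite reflexive graph compatible with a distributive lattice $L$, and identify $L$ with the downset lattice $\mathcal{D}(J_L)$ via Birkhoff's isomorphism. Then there is a unique sub-digraph $A$ of $J_L$ satisfying the condition "whenever $u'\le u\le v\le v'$ in $J_L$ and $(u',v')\in A$, then $(u,v)\in A$" such that $G=G(J_L,A)$ (in particular $G\cong G(J_L,A)$).
   Context: A lattice $L$ on $V(G)$ is compatible with the reflexive graph $G$ if whenever $u\sim u'$ and $v\sim v'$ we have $u\wedge v\sim u'\wedge v'$ and $u\vee v\sim u'\vee v'$. For a finite distributive lattice $L$, $J_L$ is the poset of join-irreducible elements of $L$, and Birkhoff's theorem gives a lattice isomorphism $L\cong\mathcal{D}(J_L)$, where $\mathcal{D}(P)$ is the lattice of downsets of a poset $P$ ordered by inclusion. A poset $P$ is viewed as a reflexive digraph with an arc $(a,b)$ whenever $a\le b$ (including loops); a sub-digraph $A$ of $P$ has the same vertex set and a subset of the arcs. The graph $G(P,A)$ has vertex set $\mathcal{D}(P)$, with $D\sim D'$ iff $A$ contains every arc $(x,y)$ of $P$ for which $x,y$ both lie in $D\setminus D'$ or both lie in $D'\setminus D$. -}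

module Defs where

open import Level using (0ℓ)
open import Data.Nat using (ℕ)
open import Data.Fin using (Fin)
open import Data.Product using (_×_; ∃)
open import Data.Sum using (_⊎_)
open import Relation.Nullary using (¬_)
open import Relation.Binary.PropositionalEquality using (_≡_)
open import Relation.Binary using (Rel; Reflexive; Symmetric)
open import Algebra.Core using (Op₂)
open import Algebra.Lattice.Structures using (IsDistributiveLattice)
open import Function.Bundles using (_⇔_)

module _ {n : ℕ} (_∨_ _∧_ : Op₂ (Fin n)) where

  _≤L_ : Fin n → Fin n → Set
  x ≤L y = x ∧ y ≡ x

  JoinIrreducible : Fin n → Set
  JoinIrreducible j = (¬ (∀ x → j ≤L x)) × (∀ x y → j ≡ x ∨ y → (j ≡ x) ⊎ (j ≡ y))

  Compatible : Rel (Fin n) 0ℓ → Set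
  Compatible _~_ = ∀ u u' v v' → u ~ u' → v ~ v' →
                   ((u ∧ v) ~ (u' ∧ v')) × ((u ∨ v) ~ (u' ∨ v'))

  birkhoff : Fin n → Fin n → Set
  birkhoff x j = JoinIrreducible j × (j ≤L x)

  SubDigraph : Rel (Fin n) 0ℓ → Set
  SubDigraph A = ∀ a b → A a b → JoinIrreducible a × JoinIrreducible b × (a ≤L b)

  Convex : Rel (Fin n) 0ℓ → Set
  Convex A = ∀ u' u v v' → JoinIrreducible u' → JoinIrreducible u →
             JoinIrreducible v → JoinIrreducible v' →
             u' ≤L u → u ≤L v → v ≤L v' → A u' v' → A u v

  -- adjacency in G(J_L, A) between downsets D, D' of J_L (given as predicates):
  -- A contains every arc (x,y) of J_L with x,y both in D∖D' or both in D'∖D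
  GAdj : Rel (Fin n) 0ℓ → (Fin n → Set) → (Fin n → Set) → Set
  GAdj A D D' = ∀ x y → JoinIrreducible x → JoinIrreducible y → x ≤L y →
                ((D x × ¬ D' x × D y × ¬ D' y) ⊎ (D' x × ¬ D x × D' y × ¬ D y)) →
                A x y

  Represents : Rel (Fin n) 0ℓ → Rel (Fin n) 0ℓ → Set
  Represents _~_ A = ∀ x y → (x ~ y) ⇔ GAdj A (birkhoff x) (birkhoff y)

  Good : Rel (Fin n) 0ℓ → Rel (Fin n) 0ℓ → Set
  Good _~_ A = SubDigraph A × Convex A × Represents _~_ A

-- For a join-irreducible u ≤ v let v ∖ u be the largest element below v but
-- not above u; under Birkhoff its downset is D(v) minus the upset of u, and
-- uniqueness forces A = {(u, v) : v ~ v ∖ u}.  By compatibility an edge x ~ y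
-- gives b ~ b ∖ a for all a, b ∈ D(x) ∖ D(y) (meet with b, then join with
-- b ∖ a); this yields one half of G = G(J_L, A) and the convexity of A.
-- Conversely, the neighbourhood of a vertex is closed under ∨ and ∧.  If all
-- arcs inside D(x) ∖ D(m), m ≤ x, lie in A, then x ~ x ∖ w for each w in the
-- difference, since x is the join of the neighbours v ∨ (x ∖ w) of x ∖ w; and
-- m is the meet of the neighbours x ∖ w of x, so x ~ m.  Joining x ~ x ∧ y
-- with x ∧ y ~ y then gives x ~ y.
module Submission where

open import Defs
open import Level using (0ℓ)
open import Data.Nat using (ℕ)
open import Data.Fin using (Fin)
open import Data.Product using (_×_; ∃; ∃₂; _,_; proj₁; proj₂)
open import Data.Sum using (_⊎_; inj₁; inj₂; [_,_])
open import Data.Empty using (⊥-elim)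
open import Data.List using (List; foldr; map; filter; allFin)
open import Data.List.Properties using (foldr-preservesᵇ; foldr-preservesᵒ)
open import Data.List.Relation.Unary.All as All using (All)
open import Data.List.Relation.Unary.All.Properties using (all-filter; map⁺)
open import Data.List.Relation.Unary.Any as Any using ()
open import Data.List.Membership.Propositional using (_∈_)
open import Data.List.Membership.Propositional.Properties using (∈-allFin; ∈-filter⁺; ∈-map⁺)
open import Data.Fin.Properties using (_≟_; any?; all?)
open import Data.Fin.Induction using (po-wellFounded)
open import Induction.WellFounded using (Acc; acc)
open import Relation.Nullary using (¬_; Dec; yes; no)
open import Relation.Nullary.Decidable using (_×-dec_; _⊎-dec_; _→-dec_; ¬?)
open import Relation.Unary using (Pred)
open import Relation.Binary using (Rel; Reflexive; Symmetric; Transitive; Antisymmetric; Decidable)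
open import Relation.Binary.Structures using (IsPartialOrder)
open import Relation.Binary.PropositionalEquality
  using (_≡_; refl; sym; trans; subst; subst₂; isEquivalence)
import Relation.Binary.Construct.NonStrictToStrict as NonStrictToStrict
import Relation.Binary.Lattice.Structures as OrderTheoretic
open import Algebra.Core using (Op₂)
open import Algebra.Lattice.Bundles using (Lattice)
open import Algebra.Lattice.Structures using (IsDistributiveLattice)
open import Algebra.Lattice.Properties.Lattice as LatticeProperties using ()
open import Function.Bundles using (_⇔_; mk⇔; Equivalence)

module FiniteDistributiveLattice
  {n : ℕ} (_∨_ _∧_ : Op₂ (Fin n)) (isDL : IsDistributiveLattice _≡_ _∨_ _∧_) where

  open IsDistributiveLattice isDL using (isLattice; ∧-distribˡ-∨)

  private
    lattice : Lattice 0ℓ 0ℓ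
    lattice = record { isLattice = isLattice }

  open LatticeProperties lattice using (∨-∧-isOrderTheoreticLattice)
  open LatticeProperties lattice public using (∧-idem; ∨-idem)
  private
    module ⊑ = OrderTheoretic.IsLattice ∨-∧-isOrderTheoreticLattice

  infix 4 _≤_ _<_

  _≤_ : Rel (Fin n) 0ℓ
  _≤_ = _≤L_ _∨_ _∧_

  JI : Fin n → Set
  JI = JoinIrreducible _∨_ _∧_

  -- The library orders a lattice by x ≡ x ∧ y, Defs by x ∧ y ≡ x.
  ≤-refl : Reflexive _≤_
  ≤-refl = sym ⊑.refl

  ≤-trans : Transitive _≤_
  ≤-trans p q = sym (⊑.trans (sym p) (sym q))

  ≤-antisym : Antisymmetric _≡_ _≤_
  ≤-antisym p q = ⊑.antisym (sym p) (sym q)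

  ≤-isPartialOrder : IsPartialOrder _≡_ _≤_
  ≤-isPartialOrder = record
    { isPreorder = record
      { isEquivalence = isEquivalence
      ; reflexive     = λ { refl → ≤-refl }
      ; trans         = ≤-trans
      }
    ; antisym = ≤-antisym
    }

  x≤x∨y : ∀ x y → x ≤ x ∨ y
  x≤x∨y x y = sym (⊑.x≤x∨y x y)

  y≤x∨y : ∀ x y → y ≤ x ∨ y
  y≤x∨y x y = sym (⊑.y≤x∨y x y)

  ∨-least : ∀ {x y z} → x ≤ z → y ≤ z → x ∨ y ≤ z
  ∨-least p q = sym (⊑.∨-least (sym p) (sym q))

  x∧y≤x : ∀ x y → x ∧ y ≤ x
  x∧y≤x x y = sym (⊑.x∧y≤x x y)

  x∧y≤y : ∀ x y → x ∧ y ≤ y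
  x∧y≤y x y = sym (⊑.x∧y≤y x y)

  ∧-greatest : ∀ {x y z} → x ≤ y → x ≤ z → x ≤ y ∧ z
  ∧-greatest p q = sym (⊑.∧-greatest (sym p) (sym q))

  x≤y⇒x∨y≡y : ∀ {x y} → x ≤ y → x ∨ y ≡ y
  x≤y⇒x∨y≡y {x} {y} p = ≤-antisym (∨-least p ≤-refl) (y≤x∨y x y)

  x≤y⇒y∨x≡y : ∀ {x y} → x ≤ y → y ∨ x ≡ y
  x≤y⇒y∨x≡y {x} {y} p = ≤-antisym (∨-least ≤-refl p) (x≤x∨y y x)

  _≤?_ : Decidable _≤_
  x ≤? y = x ∧ y ≟ x

  joinIrreducible? : ∀ j → Dec (JI j)
  joinIrreducible? j =
    ¬? (all? (j ≤?_)) ×-dec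
    all? (λ x → all? (λ y → j ≟ x ∨ y →-dec (j ≟ x ⊎-dec j ≟ y)))

  joinIrreducible⇒prime : ∀ {u a b} → JI u → u ≤ a ∨ b → u ≤ a ⊎ u ≤ b
  joinIrreducible⇒prime {u} {a} {b} (_ , irreducible) u≤a∨b
    with irreducible (u ∧ a) (u ∧ b) (trans (sym u≤a∨b) (∧-distribˡ-∨ u a b))
  ... | inj₁ u≡u∧a = inj₁ (sym u≡u∧a)
  ... | inj₂ u≡u∧b = inj₂ (sym u≡u∧b)

  _<_ : Rel (Fin n) 0ℓ
  _<_ = NonStrictToStrict._<_ _≡_ _≤_

  least⊎joinIrreducible⊎properJoin :
    ∀ x → (∀ y → x ≤ y) ⊎ JI x ⊎ ∃₂ λ a b → a < x × b < x × a ∨ b ≡ x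
  least⊎joinIrreducible⊎properJoin x with all? (x ≤?_)
  ... | yes x≤all = inj₁ x≤all
  ... | no x≰all
    with any? (λ a → any? (λ b → x ≟ a ∨ b ×-dec (¬? (x ≟ a) ×-dec ¬? (x ≟ b))))
  ...   | yes (a , b , x≡a∨b , x≢a , x≢b) = inj₂ (inj₂
          ( a , b
          , (subst (a ≤_) (sym x≡a∨b) (x≤x∨y a b) , λ a≡x → x≢a (sym a≡x))
          , (subst (b ≤_) (sym x≡a∨b) (y≤x∨y a b) , λ b≡x → x≢b (sym b≡x))
          , sym x≡a∨b ))
  ...   | no noProperJoin = inj₂ (inj₁ (x≰all , irreducible))
    where
    irreducible : ∀ a b → x ≡ a ∨ b → x ≡ a ⊎ x ≡ b
    irreducible a b x≡a∨b with x ≟ a | x ≟ b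
    ... | yes x≡a | _       = inj₁ x≡a
    ... | no _    | yes x≡b = inj₂ x≡b
    ... | no x≢a  | no x≢b  = ⊥-elim (noProperJoin (a , b , x≡a∨b , x≢a , x≢b))

  ≤-byJoinIrreducibles : ∀ {x z} → (∀ j → JI j → j ≤ x → j ≤ z) → x ≤ z
  ≤-byJoinIrreducibles {x} {z} = go x (po-wellFounded ≤-isPartialOrder x)
    where
    go : ∀ x → Acc _<_ x → (∀ j → JI j → j ≤ x → j ≤ z) → x ≤ z
    go x (acc smaller) below with least⊎joinIrreducible⊎properJoin x
    ... | inj₁ x≤all = x≤all z
    ... | inj₂ (inj₁ x-irreducible) = below x x-irreducible ≤-refl
    ... | inj₂ (inj₂ (a , b , a<x , b<x , refl)) = ∨-least
      (go a (smaller a<x) (λ j Jj j≤a → below j Jj (≤-trans j≤a (proj₁ a<x))))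
      (go b (smaller b<x) (λ j Jj j≤b → below j Jj (≤-trans j≤b (proj₁ b<x))))

  ⋁⟨_⟩ ⋀⟨_⟩ : Fin n → List (Fin n) → Fin n
  ⋁⟨ e ⟩ = foldr _∨_ e
  ⋀⟨ e ⟩ = foldr _∧_ e

  private
    ≤-∨-either : ∀ {a} x y → a ≤ x ⊎ a ≤ y → a ≤ x ∨ y
    ≤-∨-either x y = [ (λ a≤x → ≤-trans a≤x (x≤x∨y x y)) , (λ a≤y → ≤-trans a≤y (y≤x∨y x y)) ]

    ∧-≤-either : ∀ {a} x y → x ≤ a ⊎ y ≤ a → x ∧ y ≤ a
    ∧-≤-either x y = [ ≤-trans (x∧y≤x x y) , ≤-trans (x∧y≤y x y) ]

    ≤-any : ∀ {a as} → a ∈ as → Any.Any (a ≤_) as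
    ≤-any = Any.map (λ { refl → ≤-refl })

    ≥-any : ∀ {a as} → a ∈ as → Any.Any (_≤ a) as
    ≥-any = Any.map (λ { refl → ≤-refl })

  ⋁-upperᵉ : ∀ e as → e ≤ ⋁⟨ e ⟩ as
  ⋁-upperᵉ e as = foldr-preservesᵒ ≤-∨-either e as (inj₁ ≤-refl)

  ⋁-upper : ∀ {a e as} → a ∈ as → a ≤ ⋁⟨ e ⟩ as
  ⋁-upper {e = e} {as} a∈as = foldr-preservesᵒ ≤-∨-either e as (inj₂ (≤-any a∈as))

  ⋁-least : ∀ {e as z} → e ≤ z → All (_≤ z) as → ⋁⟨ e ⟩ as ≤ z
  ⋁-least = foldr-preservesᵇ ∨-least

  ⋀-lowerᵉ : ∀ e as → ⋀⟨ e ⟩ as ≤ e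
  ⋀-lowerᵉ e as = foldr-preservesᵒ ∧-≤-either e as (inj₁ ≤-refl)

  ⋀-lower : ∀ {a e as} → a ∈ as → ⋀⟨ e ⟩ as ≤ a
  ⋀-lower {e = e} {as} a∈as = foldr-preservesᵒ ∧-≤-either e as (inj₂ (≥-any a∈as))

  ⋀-greatest : ∀ {e as z} → z ≤ e → All (z ≤_) as → z ≤ ⋀⟨ e ⟩ as
  ⋀-greatest = foldr-preservesᵇ ∧-greatest

  elements : {Q : Pred (Fin n) 0ℓ} → (∀ x → Dec (Q x)) → List (Fin n)
  elements Q? = filter Q? (allFin n)

  ∈-elements : ∀ {Q : Pred (Fin n) 0ℓ} (Q? : ∀ x → Dec (Q x)) {z} → Q z → z ∈ elements Q?
  ∈-elements Q? {z} = ∈-filter⁺ Q? (∈-allFin z)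

  all-elements : ∀ {Q : Pred (Fin n) 0ℓ} (Q? : ∀ x → Dec (Q x)) → All Q (elements Q?)
  all-elements Q? = all-filter Q? (allFin n)

  -- Fin n may be empty, so the least element is computed from a given one.
  least : Fin n → Fin n
  least x = ⋀⟨ x ⟩ (allFin n)

  least-≤ : ∀ x y → least x ≤ y
  least-≤ x y = ⋀-lower (∈-allFin y)

  _∖_ : Fin n → Fin n → Fin n
  x ∖ u = ⋁⟨ least x ⟩ (elements (λ z → z ≤? x ×-dec ¬? (u ≤? z)))

  x∖u≤x : ∀ x u → x ∖ u ≤ x
  x∖u≤x x u = ⋁-least (least-≤ x x) (All.map proj₁ (all-elements _))

  u≰x∖u : ∀ {x u} → JI u → ¬ u ≤ x ∖ u
  u≰x∖u {x} {u} Ju =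
    foldr-preservesᵇ {P = λ a → ¬ u ≤ a} avoid u≰least (All.map proj₂ (all-elements _))
    where
    avoid : ∀ {a b} → ¬ u ≤ a → ¬ u ≤ b → ¬ u ≤ a ∨ b
    avoid u≰a u≰b u≤a∨b = [ u≰a , u≰b ] (joinIrreducible⇒prime Ju u≤a∨b)
    u≰least : ¬ u ≤ least x
    u≰least u≤least = proj₁ Ju (λ y → ≤-trans u≤least (least-≤ x y))

  ∖-greatest : ∀ {x u z} → z ≤ x → ¬ u ≤ z → z ≤ x ∖ u
  ∖-greatest z≤x u≰z = ⋁-upper (∈-elements _ (z≤x , u≰z))

  inDifference : ∀ {a b x y} → JI a → JI b → a ≤ b → b ≤ x → ¬ a ≤ y →
                 let D = birkhoff _∨_ _∧_ in D x a × ¬ D y a × D x b × ¬ D y b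
  inDifference Ja Jb a≤b b≤x a≰y =
    (Ja , ≤-trans a≤b b≤x) , (λ (_ , a≤y) → a≰y a≤y) ,
    (Jb , b≤x) , (λ (_ , b≤y) → a≰y (≤-trans a≤b b≤y))

module CompatibleGraph
  {n : ℕ} (_∨_ _∧_ : Op₂ (Fin n)) (isDL : IsDistributiveLattice _≡_ _∨_ _∧_)
  (adjacent : Rel (Fin n) 0ℓ) (~-refl : Reflexive adjacent) (~-sym : Symmetric adjacent)
  (compatible : Compatible _∨_ _∧_ adjacent) where

  infix 4 _~_
  _~_ : Rel (Fin n) 0ℓ
  _~_ = adjacent

  open IsDistributiveLattice isDL using (∨-absorbs-∧)
  open FiniteDistributiveLattice _∨_ _∧_ isDL

  ~-∨-closed : ∀ {c a b} → c ~ a → c ~ b → c ~ a ∨ b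
  ~-∨-closed {c} c~a c~b = subst (_~ _) (∨-idem c) (proj₂ (compatible c _ c _ c~a c~b))

  ~-∧-closed : ∀ {c a b} → c ~ a → c ~ b → c ~ a ∧ b
  ~-∧-closed {c} c~a c~b = subst (_~ _) (∧-idem c) (proj₁ (compatible c _ c _ c~a c~b))

  Arc : Rel (Fin n) 0ℓ
  Arc u v = JI u × JI v × u ≤ v × v ~ v ∖ u

  ArcsWithin : Fin n → Fin n → Set
  ArcsWithin x m = ∀ {a b} → JI a → JI b → a ≤ b → b ≤ x → ¬ a ≤ m → Arc a b

  edge⇒~∖ : ∀ {x y a b} → x ~ y → b ≤ x → ¬ a ≤ y → b ~ b ∖ a
  edge⇒~∖ {x} {y} {a} {b} x~y b≤x a≰y =
    subst₂ _~_ (x≤y⇒x∨y≡y (x∖u≤x b a)) (x≤y⇒y∨x≡y b∧y≤b∖a)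
      (proj₂ (compatible (b ∖ a) (b ∖ a) b (b ∧ y) ~-refl
        (subst (_~ b ∧ y) b≤x (proj₁ (compatible b b x y ~-refl x~y)))))
    where
    b∧y≤b∖a : b ∧ y ≤ b ∖ a
    b∧y≤b∖a = ∖-greatest (x∧y≤x b y) (λ a≤b∧y → a≰y (≤-trans a≤b∧y (x∧y≤y b y)))

  arcsWithin⇒~∖ : ∀ {x m w} → ArcsWithin x m → JI w → w ≤ x → ¬ w ≤ m → x ~ x ∖ w
  arcsWithin⇒~∖ {x} {m} {w} arcs Jw w≤x w≰m =
    subst (_~ x ∖ w) (≤-antisym t≤x x≤t) (~-sym c~t)
    where
    c : Fin n
    c = x ∖ w
    Above : Pred (Fin n) 0ℓ
    Above v = JI v × w ≤ v × v ≤ x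
    above? : ∀ v → Dec (Above v)
    above? v = joinIrreducible? v ×-dec (w ≤? v ×-dec v ≤? x)
    t : Fin n
    t = ⋁⟨ c ⟩ (map (_∨ c) (elements above?))

    c~v∨c : ∀ {v} → Above v → c ~ v ∨ c
    c~v∨c {v} (Jv , w≤v , v≤x) =
      subst (_~ v ∨ c) (x≤y⇒x∨y≡y v∖w≤c) (proj₂ (compatible _ _ c c (~-sym v~v∖w) ~-refl))
      where
      v~v∖w : v ~ v ∖ w
      v~v∖w = proj₂ (proj₂ (proj₂ (arcs Jw Jv w≤v v≤x w≰m)))
      v∖w≤c : v ∖ w ≤ c
      v∖w≤c = ∖-greatest (≤-trans (x∖u≤x v w) v≤x) (u≰x∖u Jw)

    c~t : c ~ t
    c~t = foldr-preservesᵇ {P = c ~_} ~-∨-closed ~-refl (map⁺ (All.map c~v∨c (all-elements above?)))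

    t≤x : t ≤ x
    t≤x = ⋁-least (x∖u≤x x w)
      (map⁺ (All.map (λ (_ , _ , v≤x) → ∨-least v≤x (x∖u≤x x w)) (all-elements above?)))

    x≤t : x ≤ t
    x≤t = ≤-byJoinIrreducibles below
      where
      below : ∀ j → JI j → j ≤ x → j ≤ t
      below j Jj j≤x with w ≤? j
      ... | yes w≤j = ≤-trans (x≤x∨y j c) (⋁-upper (∈-map⁺ (_∨ c) (∈-elements above? (Jj , w≤j , j≤x))))
      ... | no w≰j = ≤-trans (∖-greatest j≤x w≰j) (⋁-upperᵉ c (map (_∨ c) (elements above?)))

  arcsWithin⇒~ : ∀ {x m} → m ≤ x → ArcsWithin x m → x ~ m
  arcsWithin⇒~ {x} {m} m≤x arcs = subst (x ~_) (≤-antisym t≤m m≤t) x~t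
    where
    Outside : Pred (Fin n) 0ℓ
    Outside v = JI v × v ≤ x × ¬ v ≤ m
    outside? : ∀ v → Dec (Outside v)
    outside? v = joinIrreducible? v ×-dec (v ≤? x ×-dec ¬? (v ≤? m))
    t : Fin n
    t = ⋀⟨ x ⟩ (map (x ∖_) (elements outside?))

    x~t : x ~ t
    x~t = foldr-preservesᵇ {P = x ~_} ~-∧-closed ~-refl (map⁺ (All.map
      (λ (Jv , v≤x , v≰m) → arcsWithin⇒~∖ arcs Jv v≤x v≰m) (all-elements outside?)))

    m≤t : m ≤ t
    m≤t = ⋀-greatest m≤x (map⁺ (All.map
      (λ (_ , _ , v≰m) → ∖-greatest m≤x v≰m) (all-elements outside?)))

    t≤m : t ≤ m
    t≤m = ≤-byJoinIrreducibles below
      where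
      below : ∀ j → JI j → j ≤ t → j ≤ m
      below j Jj j≤t with j ≤? m
      ... | yes j≤m = j≤m
      ... | no j≰m = ⊥-elim (u≰x∖u Jj (≤-trans j≤t (⋀-lower
              (∈-map⁺ (x ∖_) (∈-elements outside? (Jj , ≤-trans j≤t (⋀-lowerᵉ x (map (x ∖_) (elements outside?))) , j≰m))))))

  arcs-represent : Represents _∨_ _∧_ _~_ Arc
  arcs-represent x y = mk⇔ to from
    where
    to : x ~ y → GAdj _∨_ _∧_ Arc (birkhoff _∨_ _∧_ x) (birkhoff _∨_ _∧_ y)
    to x~y a b Ja Jb a≤b (inj₁ (_ , a∉y , (_ , b≤x) , _)) =
      Ja , Jb , a≤b , edge⇒~∖ x~y b≤x (λ a≤y → a∉y (Ja , a≤y))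
    to x~y a b Ja Jb a≤b (inj₂ (_ , a∉x , (_ , b≤y) , _)) =
      Ja , Jb , a≤b , edge⇒~∖ (~-sym x~y) b≤y (λ a≤x → a∉x (Ja , a≤x))

    from : GAdj _∨_ _∧_ Arc (birkhoff _∨_ _∧_ x) (birkhoff _∨_ _∧_ y) → x ~ y
    from adj = subst₂ _~_ (∨-absorbs-∧ x y) (x≤y⇒x∨y≡y (x∧y≤y x y))
      (proj₂ (compatible x (x ∧ y) (x ∧ y) y x~x∧y (~-sym y~x∧y)))
      where
      x~x∧y : x ~ x ∧ y
      x~x∧y = arcsWithin⇒~ (x∧y≤x x y) λ Ja Jb a≤b b≤x a≰x∧y →
        adj _ _ Ja Jb a≤b (inj₁ (inDifference Ja Jb a≤b b≤x
          (λ a≤y → a≰x∧y (∧-greatest (≤-trans a≤b b≤x) a≤y))))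
      y~x∧y : y ~ x ∧ y
      y~x∧y = arcsWithin⇒~ (x∧y≤y x y) λ Ja Jb a≤b b≤y a≰x∧y →
        adj _ _ Ja Jb a≤b (inj₂ (inDifference Ja Jb a≤b b≤y
          (λ a≤x → a≰x∧y (∧-greatest a≤x (≤-trans a≤b b≤y)))))

  arcs-convex : Convex _∨_ _∧_ Arc
  arcs-convex u' u v v' _ Ju Jv _ u'≤u u≤v v≤v' (Ju' , _ , _ , v'~v'∖u') =
    Ju , Jv , u≤v , edge⇒~∖ v'~v'∖u' v≤v' (λ u≤v'∖u' → u≰x∖u Ju' (≤-trans u'≤u u≤v'∖u'))

  arcs-subDigraph : SubDigraph _∨_ _∧_ Arc
  arcs-subDigraph a b (Ja , Jb , a≤b , _) = Ja , Jb , a≤b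

  arcs-unique : ∀ A → Good _∨_ _∧_ _~_ A → ∀ a b → Arc a b ⇔ A a b
  arcs-unique A (subDigraph , convex , represents) a b = mk⇔ to from
    where
    to : Arc a b → A a b
    to (Ja , Jb , a≤b , b~b∖a) = Equivalence.to (represents b (b ∖ a)) b~b∖a a b Ja Jb a≤b
      (inj₁ (inDifference Ja Jb a≤b ≤-refl (u≰x∖u Ja)))

    adj : JI a → A a b → GAdj _∨_ _∧_ A (birkhoff _∨_ _∧_ b) (birkhoff _∨_ _∧_ (b ∖ a))
    adj Ja Aab x y Jx Jy x≤y (inj₁ ((_ , x≤b) , x∉b∖a , (_ , y≤b) , _)) with a ≤? x
    ... | yes a≤x = convex a x y b Ja Jx Jy (proj₁ (proj₂ (subDigraph a b Aab))) a≤x x≤y y≤b Aab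
    ... | no a≰x = ⊥-elim (x∉b∖a (Jx , ∖-greatest x≤b a≰x))
    adj Ja Aab x y Jx Jy x≤y (inj₂ ((_ , x≤b∖a) , x∉b , _)) =
      ⊥-elim (x∉b (Jx , ≤-trans x≤b∖a (x∖u≤x b a)))

    from : A a b → Arc a b
    from Aab with subDigraph a b Aab
    ... | Ja , Jb , a≤b = Ja , Jb , a≤b , Equivalence.from (represents b (b ∖ a)) (adj Ja Aab)

theorem4p3 : (n : ℕ) (_∨_ _∧_ : Op₂ (Fin n)) →
    IsDistributiveLattice _≡_ _∨_ _∧_ →
    (_~_ : Rel (Fin n) 0ℓ) → Reflexive _~_ → Symmetric _~_ →
    Compatible _∨_ _∧_ _~_ →
    ∃ λ (A : Rel (Fin n) 0ℓ) → Good _∨_ _∧_ _~_ A ×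
    (∀ (A' : Rel (Fin n) 0ℓ) → Good _∨_ _∧_ _~_ A' → ∀ a b → A a b ⇔ A' a b)
theorem4p3 n _∨_ _∧_ isDL _~_ ~-refl ~-sym compatible =
  Arc , (arcs-subDigraph , arcs-convex , arcs-represent) , arcs-unique
  where open CompatibleGraph _∨_ _∧_ isDL _~_ ~-refl ~-sym compatible
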